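{- Let $Y=\{z_k:k\in\mathbb{Z}\}$ and let $\mathcal{H}=\mathbb{Q}\langle Y\rangle$ be the $\mathbb{Q}$-vector space spanned by words in $Y$, with deconcatenation coproduct $\Delta(w)=\sum_{uv=w}u\otimes v$ and counit $\varepsilon$ given by $\varepsilon(\mathbf{1})=1$ and $\varepsilon(w)=0$ for nonempty words $w$. Call a word $z_{k_1}\cdots z_{k_n}$ ($n\ge1$) non-singular if $k_1\neq1$, $k_1+k_2\notin\{2,1,0,-2,-4,-6,\ldots\}$, and $k_1+\cdots+k_j\notin\mathbb{Z}_{\le j}$ for all $3\le j\le n$, and let $N$ be the linear span of non-singular words. Then $N$ is a two-sided coideal for $\Delta$, i.e. $\varepsilon(N)=0$ and $\Delta(N)\subseteq N\otimes\mathcal{H}+\mathcal{H}\otimes N$.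
   Context: Conditions on partial sums involving indices larger than the length of the word are void. -}

module Defs where

open import Data.Nat as ℕ using (ℕ; suc)
open import Data.Integer as ℤ using (ℤ; +_)
open import Data.Rational as ℚ using (ℚ; 0ℚ)
open import Data.List using (List; []; _∷_; _++_; map; concat; concatMap; take; foldr; length)
open import Data.List.Properties using (≡-dec)
open import Data.List.Relation.Unary.All using (All)
open import Data.Product using (_×_; _,_; proj₁; proj₂; ∃-syntax)
open import Data.Sum using (_⊎_)
open import Data.Bool using (if_then_else_)
open import Relation.Nullary using (¬_; Dec)
open import Relation.Nullary.Decidable using (⌊_⌋)
open import Relation.Binary.PropositionalEquality using (_≡_)
open import Data.Product.Properties renaming (≡-dec to ×-≡-dec) using ()

-- Alphabet Y = { z_k : k ∈ ℤ }; a word z_{k1}⋯z_{kn} is the list k1 ∷ ⋯ ∷ kn.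
Word : Set
Word = List ℤ

_≟w_ : (u v : Word) → Dec (u ≡ v)
_≟w_ = ≡-dec ℤ._≟_

_≟w2_ : (p q : Word × Word) → Dec (p ≡ q)
_≟w2_ = ×-≡-dec _≟w_ _≟w_

-- ℋ = ℚ⟨Y⟩: elements are finite formal ℚ-linear combinations of words,
-- represented by a list of (coefficient, word) terms; two elements are
-- equal iff they have the same coefficient on every word.
ℋ : Set
ℋ = List (ℚ × Word)

coeff : ℋ → Word → ℚ
coeff [] w = 0ℚ
coeff ((q , u) ∷ xs) w = (if ⌊ u ≟w w ⌋ then q else 0ℚ) ℚ.+ coeff xs w

_≈_ : ℋ → ℋ → Set
x ≈ y = ∀ w → coeff x w ≡ coeff y w

ℋ⊗ℋ : Set
ℋ⊗ℋ = List (ℚ × (Word × Word))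

coeff₂ : ℋ⊗ℋ → Word × Word → ℚ
coeff₂ [] p = 0ℚ
coeff₂ ((q , p′) ∷ xs) p = (if ⌊ p′ ≟w2 p ⌋ then q else 0ℚ) ℚ.+ coeff₂ xs p

_≈₂_ : ℋ⊗ℋ → ℋ⊗ℋ → Set
x ≈₂ y = ∀ p → coeff₂ x p ≡ coeff₂ y p

_⊗_ : ℋ → ℋ → ℋ⊗ℋ
x ⊗ y = concatMap (λ a → map (λ b → (proj₁ a ℚ.* proj₁ b , (proj₂ a , proj₂ b))) y) x

splits : Word → List (Word × Word)
splits [] = ([] , []) ∷ []
splits (a ∷ w) = ([] , a ∷ w) ∷ map (λ p → (a ∷ proj₁ p , proj₂ p)) (splits w)

Δ : ℋ → ℋ⊗ℋ
Δ [] = []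
Δ ((q , w) ∷ xs) = map (λ p → (q , p)) (splits w) ++ Δ xs

ε : ℋ → ℚ
ε x = coeff x []

S : ℕ → Word → ℤ
S j w = foldr ℤ._+_ (+ 0) (take j w)

Bad₂ : ℤ → Set
Bad₂ s = (s ≡ + 2) ⊎ (s ≡ + 1) ⊎ ((s ℤ.≤ + 0) × ∃[ m ] s ≡ + 2 ℤ.* m)

-- non-singular words (n ≥ 1); conditions with indices beyond the length are void
NonSingular : Word → Set
NonSingular w =
  (1 ℕ.≤ length w)
  × ¬ (S 1 w ≡ + 1)
  × (2 ℕ.≤ length w → ¬ Bad₂ (S 2 w))
  × (∀ j → 3 ℕ.≤ j → j ℕ.≤ length w → + j ℤ.< S j w)

InN : ℋ → Set
InN x = ∃[ L ] (All (λ t → NonSingular (proj₂ t)) L × (x ≈ L))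

InN⊗ℋ+ℋ⊗N : ℋ⊗ℋ → Set
InN⊗ℋ+ℋ⊗N z =
  ∃[ A ] ∃[ B ]
    (All (λ p → InN (proj₁ p)) A
    × All (λ p → InN (proj₂ p)) B
    × (z ≈₂ (concatMap (λ p → proj₁ p ⊗ proj₂ p) A ++ concatMap (λ p → proj₁ p ⊗ proj₂ p) B)))

{-# OPTIONS --safe #-}
-- The conditions defining non-singularity only involve partial sums of initial
-- segments, so every nonempty prefix of a non-singular word is non-singular.
-- Hence in Δ w = 1 ⊗ w + Σ_{uv = w, u ≠ 1} u ⊗ v the first term lies in ℋ ⊗ N
-- and all others in N ⊗ ℋ; and ε vanishes on N since non-singular words are
-- nonempty.
module Submission where

open import Defs
open import Data.Product using (_×_)
open import Data.Rational using (0ℚ)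
open import Relation.Binary.PropositionalEquality using (_≡_)

open import Algebra.Bundles using (CommutativeMonoid)
import Algebra.Properties.CommutativeSemigroup as CommSemigroupProperties
open import Data.Bool using (if_then_else_)
open import Data.Integer as ℤ using (ℤ)
open import Data.List using (List; []; _∷_; _++_; map; concatMap; foldr; take; length; filter)
open import Data.List.Properties using (++-conicalˡ; ++-conicalʳ; ∷-injectiveˡ; ∷-injectiveʳ; length-++-≤ˡ)
open import Data.List.Relation.Unary.All as All using (All; []; _∷_)
open import Data.List.Relation.Unary.All.Properties using (++⁺; map⁺; all-filter; filter⁺)
open import Data.Nat as ℕ using (zero; suc; z≤n; s≤s)
open import Data.Nat.Properties using (≤-trans)
open import Data.Product using (_,_; proj₁; proj₂)
open import Data.Rational as ℚ using (ℚ; 1ℚ; _+_)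
import Data.Rational.Properties as ℚP
open import Function using (_∘_)
open import Function.Definitions using (Injective)
open import Relation.Nullary using (¬_; Dec; yes; no; ¬?)
open import Relation.Nullary.Decidable using (⌊_⌋)
open import Relation.Unary using (Decidable)
open import Relation.Binary.PropositionalEquality using (_≢_; refl; sym; trans; cong; cong₂; subst; module ≡-Reasoning)

open CommSemigroupProperties (CommutativeMonoid.commutativeSemigroup ℚP.+-0-commutativeMonoid)
  using (x∙yz≈y∙xz)

indicator : {A : Set} → Dec A → ℚ → ℚ
indicator a? q = if ⌊ a? ⌋ then q else 0ℚ

indicator-no : {A : Set} {q : ℚ} → ¬ A → (a? : Dec A) → indicator a? q ≡ 0ℚ
indicator-no ¬a (yes a) with () ← ¬a a
indicator-no ¬a (no _)  = refl

indicator-⇔ : {A B : Set} {q : ℚ} → (A → B) → (B → A) →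
              (a? : Dec A) (b? : Dec B) → indicator a? q ≡ indicator b? q
indicator-⇔ f g (yes a) (yes b) = refl
indicator-⇔ f g (yes a) (no ¬b) with () ← ¬b (f a)
indicator-⇔ f g (no ¬a) (yes b) with () ← ¬a (g b)
indicator-⇔ f g (no ¬a) (no ¬b) = refl

coeff-absent : ∀ x w → All (λ t → proj₂ t ≢ w) x → coeff x w ≡ 0ℚ
coeff-absent [] w [] = refl
coeff-absent ((q , u) ∷ x) w (u≢w ∷ rest) =
  trans (cong₂ _+_ (indicator-no u≢w (u ≟w w)) (coeff-absent x w rest)) (ℚP.+-identityʳ 0ℚ)

coeff₂-++ : ∀ z z′ p → coeff₂ (z ++ z′) p ≡ coeff₂ z p + coeff₂ z′ p
coeff₂-++ [] z′ p = sym (ℚP.+-identityˡ _)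
coeff₂-++ ((q , p′) ∷ z) z′ p =
  trans (cong (indicator (p′ ≟w2 p) q +_) (coeff₂-++ z z′ p))
        (sym (ℚP.+-assoc (indicator (p′ ≟w2 p) q) (coeff₂ z p) (coeff₂ z′ p)))

coeff₂-filter-split : ∀ {P : ℚ × (Word × Word) → Set} (P? : Decidable P) z p →
  coeff₂ z p ≡ coeff₂ (filter (¬? ∘ P?) z) p + coeff₂ (filter P? z) p
coeff₂-filter-split P? [] p = sym (ℚP.+-identityˡ 0ℚ)
coeff₂-filter-split P? ((q , p′) ∷ z) p with P? (q , p′)
... | yes _ = trans (cong (indicator (p′ ≟w2 p) q +_) (coeff₂-filter-split P? z p))
                    (x∙yz≈y∙xz (indicator (p′ ≟w2 p) q) (coeff₂ (filter (¬? ∘ P?) z) p) (coeff₂ (filter P? z) p))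
... | no _  = trans (cong (indicator (p′ ≟w2 p) q +_) (coeff₂-filter-split P? z p))
                    (sym (ℚP.+-assoc (indicator (p′ ≟w2 p) q) (coeff₂ (filter (¬? ∘ P?) z) p) (coeff₂ (filter P? z) p)))

_·_ : ℚ → List (Word × Word) → ℋ⊗ℋ
q · ps = map (q ,_) ps

coeff₂-·-map-injective : ∀ q {f : Word × Word → Word × Word} → Injective _≡_ _≡_ f →
  ∀ ps p → coeff₂ (q · map f ps) (f p) ≡ coeff₂ (q · ps) p
coeff₂-·-map-injective q inj [] p = refl
coeff₂-·-map-injective q {f} inj (p′ ∷ ps) p =
  cong₂ _+_ (indicator-⇔ inj (cong f) (f p′ ≟w2 f p) (p′ ≟w2 p))
            (coeff₂-·-map-injective q inj ps p)

coeff₂-·-map-∉-image : ∀ q {f : Word × Word → Word × Word} p → (∀ p′ → f p′ ≢ p) →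
  ∀ ps → coeff₂ (q · map f ps) p ≡ 0ℚ
coeff₂-·-map-∉-image q p ∉image [] = refl
coeff₂-·-map-∉-image q {f} p ∉image (p′ ∷ ps) =
  trans (cong₂ _+_ (indicator-no (∉image p′) (f p′ ≟w2 p)) (coeff₂-·-map-∉-image q p ∉image ps))
        (ℚP.+-identityʳ 0ℚ)

consˡ : ℤ → Word × Word → Word × Word
consˡ a (u , v) = (a ∷ u , v)

consˡ-injective : ∀ a → Injective _≡_ _≡_ (consˡ a)
consˡ-injective a {u , v} {u′ , v′} e = cong₂ _,_ (∷-injectiveʳ (cong proj₁ e)) (cong proj₂ e)

coeff₂-splits : ∀ q w u v → coeff₂ (q · splits w) (u , v) ≡ indicator (w ≟w (u ++ v)) q
coeff₂-splits q [] u v =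
  trans (ℚP.+-identityʳ _) (indicator-⇔ (λ { refl → refl }) unsplit (([] , []) ≟w2 (u , v)) ([] ≟w (u ++ v)))
  where
  unsplit : [] ≡ u ++ v → ([] , []) ≡ (u , v)
  unsplit e = cong₂ _,_ (sym (++-conicalˡ u v (sym e))) (sym (++-conicalʳ u v (sym e)))
coeff₂-splits q (a ∷ w) [] v =
  trans (cong₂ _+_ (indicator-⇔ (cong proj₂) (cong ([] ,_)) (([] , a ∷ w) ≟w2 ([] , v)) ((a ∷ w) ≟w v))
                   (coeff₂-·-map-∉-image q ([] , v) (λ _ ()) (splits w)))
        (ℚP.+-identityʳ _)
coeff₂-splits q (a ∷ w) (b ∷ u) v =
  trans (cong (_+ coeff₂ (q · map (consˡ a) (splits w)) (b ∷ u , v))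
              (indicator-no {q = q} (λ ()) (([] , a ∷ w) ≟w2 (b ∷ u , v))))
        (trans (ℚP.+-identityˡ _) (nonempty-prefix (a ℤ.≟ b)))
  where
  nonempty-prefix : Dec (a ≡ b) →
    coeff₂ (q · map (consˡ a) (splits w)) (b ∷ u , v) ≡ indicator ((a ∷ w) ≟w (b ∷ u ++ v)) q
  nonempty-prefix (yes refl) = begin
    coeff₂ (q · map (consˡ a) (splits w)) (consˡ a (u , v))
      ≡⟨ coeff₂-·-map-injective q (consˡ-injective a) (splits w) (u , v) ⟩
    coeff₂ (q · splits w) (u , v)
      ≡⟨ coeff₂-splits q w u v ⟩
    indicator (w ≟w (u ++ v)) q
      ≡⟨ indicator-⇔ (cong (a ∷_)) ∷-injectiveʳ (w ≟w (u ++ v)) ((a ∷ w) ≟w (a ∷ u ++ v)) ⟩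
    indicator ((a ∷ w) ≟w (a ∷ u ++ v)) q ∎
    where open ≡-Reasoning
  nonempty-prefix (no a≢b) =
    trans (coeff₂-·-map-∉-image q (b ∷ u , v) (λ _ e → a≢b (∷-injectiveˡ (cong proj₁ e))) (splits w))
          (sym (indicator-no (a≢b ∘ ∷-injectiveˡ) ((a ∷ w) ≟w (b ∷ u ++ v))))

coeff₂-Δ : ∀ x u v → coeff₂ (Δ x) (u , v) ≡ coeff x (u ++ v)
coeff₂-Δ [] u v = refl
coeff₂-Δ ((q , w) ∷ x) u v =
  trans (coeff₂-++ (q · splits w) (Δ x) (u , v))
        (cong₂ _+_ (coeff₂-splits q w u v) (coeff₂-Δ x u v))

Δ-cong : ∀ x y → x ≈ y → Δ x ≈₂ Δ y
Δ-cong x y x≈y (u , v) = trans (coeff₂-Δ x u v) (trans (x≈y (u ++ v)) (sym (coeff₂-Δ y u v)))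

splits-sound : ∀ w → All (λ p → proj₁ p ++ proj₂ p ≡ w) (splits w)
splits-sound [] = refl ∷ []
splits-sound (a ∷ w) = refl ∷ map⁺ (All.map (cong (a ∷_)) (splits-sound w))

Δ-entries : ∀ {P : Word → Set} x → All (P ∘ proj₂) x →
  All (λ t → P (proj₁ (proj₂ t) ++ proj₂ (proj₂ t))) (Δ x)
Δ-entries [] [] = []
Δ-entries {P} ((q , w) ∷ x) (Pw ∷ Px) =
  ++⁺ (map⁺ (All.map (λ e → subst P (sym e) Pw) (splits-sound w))) (Δ-entries x Px)

take-++ˡ : ∀ n (u v : Word) → n ℕ.≤ length u → take n (u ++ v) ≡ take n u
take-++ˡ zero u v _ = refl
take-++ˡ (suc n) (a ∷ u) v (s≤s n≤∣u∣) = cong (a ∷_) (take-++ˡ n u v n≤∣u∣)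

S-++ˡ : ∀ j u v → j ℕ.≤ length u → S j (u ++ v) ≡ S j u
S-++ˡ j u v j≤∣u∣ = cong (foldr ℤ._+_ (ℤ.+ 0)) (take-++ˡ j u v j≤∣u∣)

nonSingular-nonempty : ∀ {w} → NonSingular w → w ≢ []
nonSingular-nonempty {[]} (() , _)
nonSingular-nonempty {_ ∷ _} _ ()

nonSingular-prefix : ∀ u v → u ≢ [] → NonSingular (u ++ v) → NonSingular u
nonSingular-prefix [] v u≢[] _ with () ← u≢[] refl
nonSingular-prefix u@(_ ∷ _) v _ (_ , S₁≢1 , S₂-good , Sⱼ-good) =
  s≤s z≤n ,
  S₁≢1 ,
  (λ 2≤∣u∣ → subst (λ s → ¬ Bad₂ s) (S-++ˡ 2 u v 2≤∣u∣) (S₂-good (lengthen 2≤∣u∣))) ,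
  (λ j 3≤j j≤∣u∣ → subst (ℤ._<_ (ℤ.+ j)) (S-++ˡ j u v j≤∣u∣) (Sⱼ-good j 3≤j (lengthen j≤∣u∣)))
  where
  lengthen : ∀ {j} → j ℕ.≤ length u → j ℕ.≤ length (u ++ v)
  lengthen j≤∣u∣ = ≤-trans j≤∣u∣ (length-++-≤ˡ u)

InN-single : ∀ q {w} → NonSingular w → InN ((q , w) ∷ [])
InN-single q {w} nonsingular = ((q , w) ∷ []) , (nonsingular ∷ []) , λ _ → refl

tensorSum : List (ℋ × ℋ) → ℋ⊗ℋ
tensorSum = concatMap (λ p → proj₁ p ⊗ proj₂ p)

pureTensor : ℚ × (Word × Word) → ℋ × ℋ
pureTensor (q , (u , v)) = ((q , u) ∷ [] , (1ℚ , v) ∷ [])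

tensorSum-pureTensors : ∀ z → tensorSum (map pureTensor z) ≡ z
tensorSum-pureTensors [] = refl
tensorSum-pureTensors ((q , p) ∷ z) = cong₂ _∷_ (cong (_, p) (ℚP.*-identityʳ q)) (tensorSum-pureTensors z)

InN⊗ℋ+ℋ⊗N-resp : ∀ z z′ → z ≈₂ z′ → InN⊗ℋ+ℋ⊗N z′ → InN⊗ℋ+ℋ⊗N z
InN⊗ℋ+ℋ⊗N-resp z z′ z≈z′ (A , B , A-in , B-in , z′≈) = A , B , A-in , B-in , λ p → trans (z≈z′ p) (z′≈ p)

LeftEmpty : ℚ × (Word × Word) → Set
LeftEmpty t = proj₁ (proj₂ t) ≡ []

leftEmpty? : Decidable LeftEmpty
leftEmpty? t = proj₁ (proj₂ t) ≟w []

Δ-nonsingular : ∀ x → All (NonSingular ∘ proj₂) x → InN⊗ℋ+ℋ⊗N (Δ x)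
Δ-nonsingular x nonsingular =
  map pureTensor prefixTerms , map pureTensor unitTerms ,
  map⁺ (All.zipWith (λ {t} → prefix-in-N {t}) (all-filter (¬? ∘ leftEmpty?) (Δ x) , filter⁺ (¬? ∘ leftEmpty?) entries)) ,
  map⁺ (All.zipWith (λ {t} → suffix-in-N {t}) (all-filter leftEmpty? (Δ x) , filter⁺ leftEmpty? entries)) ,
  decomposition
  where
  prefixTerms unitTerms : ℋ⊗ℋ
  prefixTerms = filter (¬? ∘ leftEmpty?) (Δ x)
  unitTerms = filter leftEmpty? (Δ x)

  entries : All (λ t → NonSingular (proj₁ (proj₂ t) ++ proj₂ (proj₂ t))) (Δ x)
  entries = Δ-entries x nonsingular

  prefix-in-N : ∀ {t} → ¬ LeftEmpty t × NonSingular (proj₁ (proj₂ t) ++ proj₂ (proj₂ t)) →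
                InN (proj₁ (pureTensor t))
  prefix-in-N {q , (u , v)} (u≢[] , ns) = InN-single q (nonSingular-prefix u v u≢[] ns)

  suffix-in-N : ∀ {t} → LeftEmpty t × NonSingular (proj₁ (proj₂ t) ++ proj₂ (proj₂ t)) →
                InN (proj₂ (pureTensor t))
  suffix-in-N {q , ([] , v)} (refl , ns) = InN-single 1ℚ ns

  decomposition : Δ x ≈₂ (tensorSum (map pureTensor prefixTerms) ++ tensorSum (map pureTensor unitTerms))
  decomposition p = begin
    coeff₂ (Δ x) p                                  ≡⟨ coeff₂-filter-split leftEmpty? (Δ x) p ⟩
    coeff₂ prefixTerms p + coeff₂ unitTerms p       ≡⟨ sym (coeff₂-++ prefixTerms unitTerms p) ⟩
    coeff₂ (prefixTerms ++ unitTerms) p             ≡⟨ cong (λ z → coeff₂ z p) (sym (cong₂ _++_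
                                                         (tensorSum-pureTensors prefixTerms)
                                                         (tensorSum-pureTensors unitTerms))) ⟩
    coeff₂ (tensorSum (map pureTensor prefixTerms) ++ tensorSum (map pureTensor unitTerms)) p ∎
    where open ≡-Reasoning

corollary4p4 : (x : ℋ) → InN x → (ε x ≡ 0ℚ) × InN⊗ℋ+ℋ⊗N (Δ x)
corollary4p4 x (L , nonsingular , x≈L) =
  trans (x≈L []) (coeff-absent L [] (All.map nonSingular-nonempty nonsingular)) ,
  InN⊗ℋ+ℋ⊗N-resp (Δ x) (Δ L) (Δ-cong x L x≈L) (Δ-nonsingular L nonsingular)
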